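{- For all natural numbers $i,j$, $d(R_{2,i},R_{3,j})\ge 3^{ -(i+j)}$.
   Context: For integers $b\ge2$ and $c\ge0$, $R_{b,c}=[\frac13,\frac23]\cap\{\frac{a}{b^c}:a\in\mathbb Z\}$. For $X,Y\subseteq\mathbb R$, $d(X,Y)$ is the infimum of $|x-y|$ over $x\in X$, $y\in Y$. -}

module Defs where

open import Data.Nat as ℕ using (ℕ; NonZero)
open import Data.Nat.Properties using (m^n≢0)
open import Data.Integer using (ℤ; +_)
open import Data.Rational using (ℚ; _/_; _≤_; _-_; ∣_∣)
open import Data.Product using (_×_; ∃)
open import Relation.Binary.PropositionalEquality using (_≡_)

pow-nz : (b : ℕ) → .{{NonZero b}} → (c : ℕ) → NonZero (b ℕ.^ c)
pow-nz b c = m^n≢0 b c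

InR : (b : ℕ) → .{{NonZero b}} → ℕ → ℚ → Set
InR b c x = ((+ 1 / 3) ≤ x) × (x ≤ (+ 2 / 3))
          × ∃ λ (a : ℤ) → x ≡ _/_ a (b ℕ.^ c) {{pow-nz b c}}

-- d(X,Y) ≥ r, i.e. r is a lower bound of { |x - y| : x ∈ X, y ∈ Y }
-- (equivalently r ≤ inf, with inf ∅ = +∞)
DistGe : (ℚ → Set) → (ℚ → Set) → ℚ → Set
DistGe X Y r = ∀ x y → X x → Y y → r ≤ ∣ x - y ∣

-- Write x = a / 2^i and y = b / 3^j. If x = y, then 2^i divides a·3^j, hence a by coprimality,
-- so x would be an integer, and [1/3, 2/3] contains none. Thus a·3^j − b·2^i is a nonzero
-- integer and |x − y| = |a·3^j − b·2^i| / (2^i·3^j) ≥ 1 / (2^i·3^j) ≥ 1 / 3^(i+j).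
module Submission where

open import Defs
open import Data.Nat as ℕ using (ℕ; zero; suc; _^_; NonZero; s≤s)
open import Data.Integer as ℤ using (ℤ; +_; -[1+_])
open import Data.Rational using (_/_; _≤_; _-_; ∣_∣; toℚᵘ)

import Data.Nat.Properties as ℕ
open import Data.Nat.Coprimality as Coprime using (Coprime; 1-coprimeTo; coprime-+)
open import Data.Nat.Divisibility using (∣-trans)
import Data.Integer.Properties as ℤ
open import Data.Integer.Divisibility using (_∣_; divides)
import Data.Integer.Coprimality as ℤ
open import Data.Rational.Properties
  using (toℚᵘ-fromℚᵘ; toℚᵘ-homo-∣-∣; toℚᵘ-homo-+; toℚᵘ-homo‿-; toℚᵘ-mono-≤; toℚᵘ-cancel-≤)
open import Data.Rational.Unnormalised as ℚᵘ using (mkℚᵘ; *≤*)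
  renaming (_/_ to _/ᵘ_; _≃_ to _≃ᵘ_; _≤_ to _≤ᵘ_)
import Data.Rational.Unnormalised.Properties as ℚᵘ
open import Data.Product using (_,_)
open import Function using (_∘_)
open import Relation.Nullary using (¬_)
open import Relation.Binary.PropositionalEquality
  using (_≡_; _≢_; refl; sym; trans; cong; subst₂)

coprime-*ʳ : ∀ {m n o} → Coprime m n → Coprime m o → Coprime m (n ℕ.* o)
coprime-*ʳ {m} {n} m⊥n m⊥o {d} (d∣m , d∣no) = m⊥o (d∣m , Coprime.coprime-divisor d⊥n d∣no)
  where
  d⊥n : Coprime d n
  d⊥n (e∣d , e∣n) = m⊥n (∣-trans e∣d d∣m , e∣n)

coprime-^ʳ : ∀ {m n} j → Coprime m n → Coprime m (n ^ j)
coprime-^ʳ {m} zero    _   = Coprime.sym (1-coprimeTo m)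
coprime-^ʳ     (suc j) m⊥n = coprime-*ʳ m⊥n (coprime-^ʳ j m⊥n)

coprime-^ : ∀ {m n} i j → Coprime m n → Coprime (m ^ i) (n ^ j)
coprime-^ i j m⊥n = Coprime.sym (coprime-^ʳ i (Coprime.sym (coprime-^ʳ j m⊥n)))

2-coprimeTo-3 : Coprime 2 3
2-coprimeTo-3 = Coprime.sym (coprime-+ (1-coprimeTo 2))

coprime-cross-≡⇒∣ : ∀ {a b m n} → Coprime m n → a ℤ.* + n ≡ b ℤ.* + m → + m ∣ a
coprime-cross-≡⇒∣ {a} {b} {m} {n} m⊥n an≡bm =
  ℤ.coprime-divisor (+ m) (+ n) a m⊥n (divides ℤ.∣ b ∣ ∣na∣≡∣b∣m)
  where
  ∣na∣≡∣b∣m : ℤ.∣ + n ℤ.* a ∣ ≡ ℤ.∣ b ∣ ℕ.* m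
  ∣na∣≡∣b∣m = trans (cong ℤ.∣_∣ (trans (ℤ.*-comm (+ n) a) an≡bm)) (ℤ.abs-* b (+ m))

toℚᵘ-/ : ∀ a n .{{_ : NonZero n}} → toℚᵘ (a / n) ≃ᵘ a /ᵘ n
toℚᵘ-/ a (suc n) = toℚᵘ-fromℚᵘ (mkℚᵘ a n)

/-cancel-≤ : ∀ a b m n .{{_ : NonZero m}} .{{_ : NonZero n}} →
             a / m ≤ b / n → a ℤ.* + n ℤ.≤ b ℤ.* + m
/-cancel-≤ a b m@(suc _) n@(suc _) a/m≤b/n = ℚᵘ.drop-*≤*
  (ℚᵘ.≤-respˡ-≃ (toℚᵘ-/ a m) (ℚᵘ.≤-respʳ-≃ (toℚᵘ-/ b n) (toℚᵘ-mono-≤ a/m≤b/n)))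

no-multiple-between-thirds : ∀ k m .{{_ : NonZero m}} → m ℕ.≤ k ℕ.* m ℕ.* 3 → ¬ k ℕ.* m ℕ.* 3 ℕ.≤ 2 ℕ.* m
no-multiple-between-thirds zero    (suc m) ()
no-multiple-between-thirds (suc k) m _ km3≤2m with ℕ.*-cancelʳ-≤ 3 2 m 3m≤2m
  where
  3m≤2m : 3 ℕ.* m ℕ.≤ 2 ℕ.* m
  3m≤2m = ℕ.≤-trans (ℕ.≤-reflexive (ℕ.*-comm 3 m))
            (ℕ.≤-trans (ℕ.*-monoˡ-≤ 3 (ℕ.m≤m+n m (k ℕ.* m))) km3≤2m)
... | s≤s (s≤s ())

between-thirds⇒∤ : ∀ a m .{{_ : NonZero m}} → + 1 / 3 ≤ a / m → a / m ≤ + 2 / 3 → ¬ (+ m ∣ a)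
between-thirds⇒∤ -[1+ n ] m@(suc _) 1/3≤a/m _ _ with /-cancel-≤ (+ 1) -[1+ n ] 3 m 1/3≤a/m
... | ()
between-thirds⇒∤ (+ a) m 1/3≤a/m a/m≤2/3 (divides k refl) =
  no-multiple-between-thirds k m (ℤ.drop‿+≤+ m≤3a) (ℤ.drop‿+≤+ 3a≤2m)
  where
  m≤3a : + m ℤ.≤ + (k ℕ.* m ℕ.* 3)
  m≤3a = subst₂ ℤ._≤_ (ℤ.*-identityˡ (+ m)) (sym (ℤ.pos-* (k ℕ.* m) 3))
           (/-cancel-≤ (+ 1) (+ a) 3 m 1/3≤a/m)
  3a≤2m : + (k ℕ.* m ℕ.* 3) ℤ.≤ + (2 ℕ.* m)
  3a≤2m = subst₂ ℤ._≤_ (sym (ℤ.pos-* (k ℕ.* m) 3)) (sym (ℤ.pos-* 2 m))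
           (/-cancel-≤ (+ a) (+ 2) m 3 a/m≤2/3)

1/k≤∣a/m-b/n∣ᵘ : ∀ a b m n k .{{_ : NonZero m}} .{{_ : NonZero n}} .{{_ : NonZero k}} →
                a ℤ.* + n ≢ b ℤ.* + m → m ℕ.* n ℕ.≤ k → + 1 /ᵘ k ≤ᵘ ℚᵘ.∣ a /ᵘ m ℚᵘ.- b /ᵘ n ∣
1/k≤∣a/m-b/n∣ᵘ a b m@(suc _) n@(suc _) k@(suc _) an≢bm mn≤k = *≤* (subst₂ ℤ._≤_
  (sym (ℤ.*-identityˡ (+ (m ℕ.* n)))) (ℤ.pos-* ℤ.∣ d ∣ k) (ℤ.+≤+ (ℕ.≤-trans mn≤k (ℕ.m≤n*m k ℤ.∣ d ∣))))
  where
  d : ℤ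
  d = a ℤ.* + n ℤ.+ ℤ.- b ℤ.* + m
  d≢0 : d ≢ + 0
  d≢0 = an≢bm ∘ ℤ.i-j≡0⇒i≡j _ _ ∘ trans (cong (λ t → a ℤ.* + n ℤ.+ t) (ℤ.neg-distribˡ-* b (+ m)))
  instance
    ∣d∣≢0 : NonZero ℤ.∣ d ∣
    ∣d∣≢0 = ℕ.≢-nonZero (d≢0 ∘ ℤ.∣i∣≡0⇒i≡0)

1/k≤∣a/m-b/n∣ : ∀ a b m n k .{{_ : NonZero m}} .{{_ : NonZero n}} .{{_ : NonZero k}} →
               a ℤ.* + n ≢ b ℤ.* + m → m ℕ.* n ℕ.≤ k → + 1 / k ≤ ∣ a / m - b / n ∣
1/k≤∣a/m-b/n∣ a b m n k an≢bm mn≤k = toℚᵘ-cancel-≤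
  (ℚᵘ.≤-respˡ-≃ (ℚᵘ.≃-sym (toℚᵘ-/ (+ 1) k))
    (ℚᵘ.≤-respʳ-≃ (ℚᵘ.≃-sym toℚᵘ-dist) (1/k≤∣a/m-b/n∣ᵘ a b m n k an≢bm mn≤k)))
  where
  toℚᵘ-dist : toℚᵘ ∣ a / m - b / n ∣ ≃ᵘ ℚᵘ.∣ a /ᵘ m ℚᵘ.- b /ᵘ n ∣
  toℚᵘ-dist = ℚᵘ.≃-trans (toℚᵘ-homo-∣-∣ (a / m - b / n)) (ℚᵘ.∣-∣-cong
    (ℚᵘ.≃-trans (toℚᵘ-homo-+ (a / m) _)
      (ℚᵘ.+-cong (toℚᵘ-/ a m) (ℚᵘ.≃-trans (toℚᵘ-homo‿- (b / n)) (ℚᵘ.-‿cong (toℚᵘ-/ b n))))))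

2^i*3^j≤3^[i+j] : ∀ i j → 2 ^ i ℕ.* 3 ^ j ℕ.≤ 3 ^ (i ℕ.+ j)
2^i*3^j≤3^[i+j] i j = ℕ.≤-trans (ℕ.*-monoˡ-≤ (3 ^ j) (ℕ.^-monoˡ-≤ i (ℕ.n≤1+n 2)))
  (ℕ.≤-reflexive (sym (ℕ.^-distribˡ-+-* 3 i j)))

lemma15 : (i j : ℕ) → DistGe (InR 2 i) (InR 3 j) (_/_ (+ 1) (3 ℕ.^ (i ℕ.+ j)) {{pow-nz 3 (i ℕ.+ j)}})
lemma15 i j _ _ (1/3≤x , x≤2/3 , a , refl) (_ , _ , b , refl) =
  1/k≤∣a/m-b/n∣ a b (2 ^ i) (3 ^ j) (3 ^ (i ℕ.+ j)) x≢y (2^i*3^j≤3^[i+j] i j)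
  where
  instance
    2^i≢0 : NonZero (2 ^ i)
    2^i≢0 = pow-nz 2 i
    3^j≢0 : NonZero (3 ^ j)
    3^j≢0 = pow-nz 3 j
    3^[i+j]≢0 : NonZero (3 ^ (i ℕ.+ j))
    3^[i+j]≢0 = pow-nz 3 (i ℕ.+ j)
  x≢y : a ℤ.* + 3 ^ j ≢ b ℤ.* + 2 ^ i
  x≢y = between-thirds⇒∤ a (2 ^ i) 1/3≤x x≤2/3 ∘ coprime-cross-≡⇒∣ {a} {b} (coprime-^ i j 2-coprimeTo-3)
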